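{- Let $G$ be a graph with $n$ vertices in which every vertex has degree either $d$ or $d+1$. Then there exists an $r$-regular graph $R$ on the same vertex set, with $r=d$ or $r=d+1$, such that $|E(G)\,\triangle\,E(R)|\le 3n/2$. -}

module Defs where

open import Data.Nat using (ℕ; _<ᵇ_)
open import Data.Bool using (Bool; true; false; if_then_else_; _∧_; _xor_)
open import Data.Fin using (Fin; toℕ)
open import Data.List using (List; map; allFin)
open import Data.Nat.ListAction using (sum)
open import Relation.Binary.PropositionalEquality using (_≡_)

record Graph (n : ℕ) : Set where
  field
    adj    : Fin n → Fin n → Bool
    sym    : ∀ i j → adj i j ≡ adj j i
    irrefl : ∀ i → adj i i ≡ false
open Graph public

𝟙 : Bool → ℕ
𝟙 b = if b then 1 else 0

countFin : (n : ℕ) → (Fin n → Bool) → ℕ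
countFin n p = sum (map (λ j → 𝟙 (p j)) (allFin n))

degree : {n : ℕ} → Graph n → Fin n → ℕ
degree {n} G i = countFin n (adj G i)

Regular : {n : ℕ} → ℕ → Graph n → Set
Regular r G = ∀ i → degree G i ≡ r

-- |E(G) △ E(H)|: number of unordered pairs {i,j} (counted once, as i < j)
-- that are an edge of exactly one of G, H
symDiffSize : {n : ℕ} → Graph n → Graph n → ℕ
symDiffSize {n} G H =
  sum (map (λ i → countFin n (λ j → (toℕ i <ᵇ toℕ j) ∧ (adj G i j xor adj H i j))) (allFin n))

{-# OPTIONS --safe #-}
module Submission where

-- Call a vertex high if its degree is d + 1.  Two distinct high vertices s₁, s₂ can both be
-- lowered to degree d, keeping every other degree, by changing at most three edges: delete s₁s₂
-- if it is an edge; otherwise take a neighbour x of s₁ and a neighbour y ≠ x of s₂ with xy not an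
-- edge (if there were none, x would have larger degree than s₂), delete s₁x and s₂y, and add xy.
-- If the number h of high vertices is even, pairing them off yields a d-regular graph differing
-- from G in at most 3h/2 ≤ 3n/2 edges.  If h is odd, then so is n, because n·d + h is twice the
-- number of edges.  The complement of G has degrees n − d − 2 and n − d − 1, and its high vertices
-- are the n − h low vertices of G, an even number; the complement of the regular graph obtained
-- for it is (d + 1)-regular and lies at the same distance from G.

open import Defs renaming (sym to adj-sym)
open import Data.Bool.Base using (Bool; true; false; not; _∧_; _∨_; _xor_)
open import Data.Bool.Properties
  using (∧-comm; ∨-comm; ∨-identityʳ; xor-same; xor-identityʳ; not-distribˡ-xor; not-distribʳ-xor)
  renaming (_≟_ to _≟ᵇ_)
open import Data.Empty using (⊥-elim)
open import Data.Fin.Base using (Fin; zero; suc; toℕ)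
open import Data.Fin.Permutation using (transpose; _⟨$⟩ʳ_)
open import Data.Fin.Properties using (_≟_; any?; toℕ-injective)
  renaming (suc-injective to Fin-suc-injective)
open import Data.List.Base using (map; allFin; tabulate)
open import Data.List.Properties using (map-cong; map-tabulate)
open import Data.Nat.Base
  using (ℕ; zero; suc; _+_; _*_; _≤_; _<_; z≤n; s≤s; z<s; s≤s⁻¹; _<ᵇ_; parity)
open import Data.Nat.ListAction using (sum)
open import Data.Nat.Properties
  using ( +-0-commutativeMonoid; +-commutativeSemigroup; module ≤-Reasoning
        ; +-assoc; +-comm; +-suc; +-identityʳ; +-cancelʳ-≡; *-identityʳ; *-zeroʳ; *-distribˡ-+
        ; *-cancelˡ-≡; suc-injective; ≤-refl; ≤-reflexive; ≤-trans; ≤-antisym; <-irrefl; <-asym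
        ; <⇒≱; ≮⇒≥; n≤1+n; n<1+n; m≤m+n; m≤n+m; n≢0⇒n>0; +-mono-≤; +-monoʳ-≤; +-mono-<-≤
        ; +-mono-≤-<; *-monoʳ-≤; <ᵇ-reflects-<)
  renaming (_≟_ to _≟ℕ_)
open import Data.Parity.Base as ℙ using (0ℙ; 1ℙ)
open import Data.Parity.Properties using (+-homo-+; *-homo-*)
open import Data.Product using (Σ; ∃; ∃₂; _×_; _,_; proj₁; proj₂)
open import Data.Sum using (_⊎_; inj₁; inj₂)
open import Function.Base using (id; _∘_)
open import Relation.Binary.PropositionalEquality
open import Relation.Nullary using (Dec; yes; no; does; ofʸ; ofⁿ)
open import Relation.Nullary.Decidable using (dec-true; dec-false; _×-dec_; ¬?)

open import Algebra.Properties.CommutativeMonoid.Sum +-0-commutativeMonoid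
  using (sum-syntax; sum-cong-≗; ∑-distrib-+; ∑-comm; ∑-permute)
open import Algebra.Properties.CommutativeSemigroup +-commutativeSemigroup using (xy∙z≈zy∙x)

variable
  n : ℕ

sum-tabulate : (f : Fin n → ℕ) → sum (tabulate f) ≡ ∑[ i < n ] f i
sum-tabulate {zero} f = refl
sum-tabulate {suc n} f = cong (f zero +_) (sum-tabulate (f ∘ suc))

sum-map-allFin : (f : Fin n → ℕ) → sum (map f (allFin n)) ≡ ∑[ i < n ] f i
sum-map-allFin f = trans (cong sum (map-tabulate id f)) (sum-tabulate f)

∑-const : ∀ n c → ∑[ i < n ] c ≡ n * c
∑-const zero c = refl
∑-const (suc n) c = cong (c +_) (∑-const n c)

∑-mono-≤ : {f g : Fin n → ℕ} → (∀ i → f i ≤ g i) → ∑[ i < n ] f i ≤ ∑[ i < n ] g i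
∑-mono-≤ {zero} f≤g = z≤n
∑-mono-≤ {suc n} f≤g = +-mono-≤ (f≤g zero) (∑-mono-≤ (f≤g ∘ suc))

∑-mono-< : {f g : Fin n → ℕ} (k : Fin n) →
           (∀ i → f i ≤ g i) → f k < g k → ∑[ i < n ] f i < ∑[ i < n ] g i
∑-mono-< zero f≤g fk<gk = +-mono-<-≤ fk<gk (∑-mono-≤ (f≤g ∘ suc))
∑-mono-< (suc k) f≤g fk<gk = +-mono-≤-< (f≤g zero) (∑-mono-< k (f≤g ∘ suc) fk<gk)

term≤∑ : (f : Fin n → ℕ) (k : Fin n) → f k ≤ ∑[ i < n ] f i
term≤∑ f zero = m≤m+n _ _
term≤∑ f (suc k) = ≤-trans (term≤∑ (f ∘ suc) k) (m≤n+m _ _)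

∑-update : {f g : Fin n → ℕ} (k : Fin n) → (∀ i → i ≢ k → f i ≡ g i) →
           ∑[ i < n ] f i + g k ≡ ∑[ i < n ] g i + f k
∑-update {suc n} {f} {g} zero f≡g = begin
  f zero + ∑[ i < n ] f (suc i) + g zero
    ≡⟨ cong (λ s → f zero + s + g zero) (sum-cong-≗ (λ i → f≡g (suc i) λ ())) ⟩
  f zero + ∑[ i < n ] g (suc i) + g zero
    ≡⟨ xy∙z≈zy∙x (f zero) _ (g zero) ⟩
  g zero + ∑[ i < n ] g (suc i) + f zero
    ∎
  where open ≡-Reasoning
∑-update {suc n} {f} {g} (suc k) f≡g = begin
  f zero + ∑[ i < n ] f (suc i) + g (suc k)
    ≡⟨ +-assoc (f zero) _ _ ⟩
  f zero + (∑[ i < n ] f (suc i) + g (suc k))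
    ≡⟨ cong₂ _+_ (f≡g zero λ ()) (∑-update k λ i i≢k → f≡g (suc i) (i≢k ∘ Fin-suc-injective)) ⟩
  g zero + (∑[ i < n ] g (suc i) + f (suc k))
    ≡⟨ +-assoc (g zero) _ _ ⟨
  g zero + ∑[ i < n ] g (suc i) + f (suc k)
    ∎
  where open ≡-Reasoning

infix 7 _==_
_==_ : Fin n → Fin n → Bool
i == j = does (i ≟ j)

==-refl : (i : Fin n) → (i == i) ≡ true
==-refl i = dec-true (i ≟ i) refl

==-≢ : {i j : Fin n} → i ≢ j → (i == j) ≡ false
==-≢ {i = i} {j} = dec-false (i ≟ j)

==-sym : (i j : Fin n) → (i == j) ≡ (j == i)
==-sym i j with i ≟ j
... | yes refl = sym (==-refl i)
... | no i≢j = sym (==-≢ (i≢j ∘ sym))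

countFin-∑ : (p : Fin n → Bool) → countFin n p ≡ ∑[ j < n ] 𝟙 (p j)
countFin-∑ p = sum-map-allFin (𝟙 ∘ p)

countFin-cong : {p q : Fin n → Bool} → (∀ j → p j ≡ q j) → countFin n p ≡ countFin n q
countFin-cong {n} p≡q = cong sum (map-cong (cong 𝟙 ∘ p≡q) (allFin n))

countFin-false : countFin n (λ _ → false) ≡ 0
countFin-false {n} = trans (countFin-∑ {n} (λ _ → false)) (trans (∑-const n 0) (*-zeroʳ n))

countFin-not : (p : Fin n → Bool) → countFin n (not ∘ p) + countFin n p ≡ n
countFin-not {n} p = begin
  countFin n (not ∘ p) + countFin n p             ≡⟨ cong₂ _+_ (countFin-∑ (not ∘ p)) (countFin-∑ p) ⟩
  ∑[ j < n ] 𝟙 (not (p j)) + ∑[ j < n ] 𝟙 (p j)   ≡⟨ ∑-distrib-+ (𝟙 ∘ not ∘ p) (𝟙 ∘ p) ⟨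
  ∑[ j < n ] (𝟙 (not (p j)) + 𝟙 (p j))            ≡⟨ sum-cong-≗ (λ j → exactly-one (p j)) ⟩
  ∑[ j < n ] 1                                    ≡⟨ ∑-const n 1 ⟩
  n * 1                                           ≡⟨ *-identityʳ n ⟩
  n                                               ∎
  where
  open ≡-Reasoning
  exactly-one : ∀ b → 𝟙 (not b) + 𝟙 b ≡ 1
  exactly-one true = refl
  exactly-one false = refl

countFin-≤ : (p : Fin n → Bool) → countFin n p ≤ n
countFin-≤ {n} p = subst (countFin n p ≤_) (countFin-not p) (m≤n+m _ (countFin n (not ∘ p)))

countFin-subadditive : {p q r : Fin n → Bool} → (∀ j → 𝟙 (p j) ≤ 𝟙 (q j) + 𝟙 (r j)) →
                       countFin n p ≤ countFin n q + countFin n r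
countFin-subadditive {n} {p} {q} {r} pointwise = begin
  countFin n p                              ≡⟨ countFin-∑ p ⟩
  ∑[ j < n ] 𝟙 (p j)                        ≤⟨ ∑-mono-≤ pointwise ⟩
  ∑[ j < n ] (𝟙 (q j) + 𝟙 (r j))            ≡⟨ ∑-distrib-+ (𝟙 ∘ q) (𝟙 ∘ r) ⟩
  ∑[ j < n ] 𝟙 (q j) + ∑[ j < n ] 𝟙 (r j)   ≡⟨ cong₂ _+_ (countFin-∑ q) (countFin-∑ r) ⟨
  countFin n q + countFin n r               ∎
  where open ≤-Reasoning

countFin-flip : (k : Fin n) (p : Fin n → Bool) →
                countFin n (λ j → (j == k) xor p j) + 𝟙 (p k) ≡ countFin n p + 𝟙 (not (p k))
countFin-flip {n} k p = begin
  countFin n (λ j → (j == k) xor p j) + 𝟙 (p k)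
    ≡⟨ cong (_+ 𝟙 (p k)) (countFin-∑ (λ j → (j == k) xor p j)) ⟩
  ∑[ j < n ] 𝟙 ((j == k) xor p j) + 𝟙 (p k)
    ≡⟨ ∑-update k (λ j j≢k → cong (λ b → 𝟙 (b xor p j)) (==-≢ j≢k)) ⟩
  ∑[ j < n ] 𝟙 (p j) + 𝟙 ((k == k) xor p k)
    ≡⟨ cong₂ (λ s b → s + 𝟙 (b xor p k)) (countFin-∑ p) (sym (==-refl k)) ⟨
  countFin n p + 𝟙 (not (p k))
    ∎
  where open ≡-Reasoning

countFin-flip-true : (k : Fin n) (p : Fin n → Bool) → p k ≡ true →
                     suc (countFin n (λ j → (j == k) xor p j)) ≡ countFin n p
countFin-flip-true {n} k p pk = begin
  suc flipped                    ≡⟨ +-comm 1 flipped ⟩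
  flipped + 1                    ≡⟨ cong (λ b → flipped + 𝟙 b) pk ⟨
  flipped + 𝟙 (p k)              ≡⟨ countFin-flip k p ⟩
  countFin n p + 𝟙 (not (p k))   ≡⟨ cong (λ b → countFin n p + 𝟙 (not b)) pk ⟩
  countFin n p + 0               ≡⟨ +-identityʳ (countFin n p) ⟩
  countFin n p                   ∎
  where
  open ≡-Reasoning
  flipped = countFin n (λ j → (j == k) xor p j)

countFin-flip-false : (k : Fin n) (p : Fin n → Bool) → p k ≡ false →
                      countFin n (λ j → (j == k) xor p j) ≡ suc (countFin n p)
countFin-flip-false {n} k p pk = begin
  flipped                        ≡⟨ +-identityʳ flipped ⟨
  flipped + 0                    ≡⟨ cong (λ b → flipped + 𝟙 b) pk ⟨
  flipped + 𝟙 (p k)              ≡⟨ countFin-flip k p ⟩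
  countFin n p + 𝟙 (not (p k))   ≡⟨ cong (λ b → countFin n p + 𝟙 (not b)) pk ⟩
  countFin n p + 1               ≡⟨ +-comm (countFin n p) 1 ⟩
  suc (countFin n p)             ∎
  where
  open ≡-Reasoning
  flipped = countFin n (λ j → (j == k) xor p j)

countFin-indicator : (k : Fin n) → countFin n (_== k) ≡ 1
countFin-indicator {n} k = begin
  countFin n (_== k)                      ≡⟨ countFin-cong (λ j → xor-identityʳ (j == k)) ⟨
  countFin n (λ j → (j == k) xor false)   ≡⟨ countFin-flip-false k (λ _ → false) refl ⟩
  suc (countFin n (λ _ → false))          ≡⟨ cong suc (countFin-false {n}) ⟩
  1                                       ∎
  where open ≡-Reasoning

countFin-∧-indicator : (c : Bool) (k : Fin n) → countFin n (λ j → c ∧ (j == k)) ≡ 𝟙 c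
countFin-∧-indicator true k = countFin-indicator k
countFin-∧-indicator {n} false k = countFin-false {n}

countFin-positive : (p : Fin n → Bool) (k : Fin n) → p k ≡ true → 0 < countFin n p
countFin-positive {n} p k pk = begin-strict
  0                    <⟨ z<s ⟩
  1                    ≡⟨ cong 𝟙 pk ⟨
  𝟙 (p k)              ≤⟨ term≤∑ (𝟙 ∘ p) k ⟩
  ∑[ j < n ] 𝟙 (p j)   ≡⟨ countFin-∑ p ⟨
  countFin n p         ∎
  where open ≤-Reasoning

countFin-witness : (p : Fin n → Bool) → 0 < countFin n p → ∃ λ i → p i ≡ true
countFin-witness p pos = go p (subst (0 <_) (countFin-∑ p) pos)
  where
  go : ∀ {n} (p : Fin n → Bool) → 0 < ∑[ j < n ] 𝟙 (p j) → ∃ λ i → p i ≡ true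
  go {suc n} p pos with p zero in p0
  ... | true = zero , p0
  ... | false = let i , pi = go (p ∘ suc) pos in suc i , pi

countFin-two-witnesses : (p : Fin n → Bool) → 2 ≤ countFin n p →
                         ∃₂ λ i j → i ≢ j × p i ≡ true × p j ≡ true
countFin-two-witnesses p 2≤ = go p (subst (2 ≤_) (countFin-∑ p) 2≤)
  where
  go : ∀ {n} (p : Fin n → Bool) → 2 ≤ ∑[ j < n ] 𝟙 (p j) →
       ∃₂ λ i j → i ≢ j × p i ≡ true × p j ≡ true
  go {suc n} p 2≤ with p zero in p0
  ... | true =
    let j , pj = countFin-witness (p ∘ suc) (subst (1 ≤_) (sym (countFin-∑ (p ∘ suc))) (s≤s⁻¹ 2≤))
    in zero , suc j , (λ ()) , p0 , pj
  ... | false =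
    let i , j , i≢j , pi , pj = go (p ∘ suc) 2≤
    in suc i , suc j , i≢j ∘ Fin-suc-injective , pi , pj

-- Symmetric difference, toggling an edge, complement

adj⇒≢ : (G : Graph n) {i j : Fin n} → adj G i j ≡ true → i ≢ j
adj⇒≢ G {i} ij refl with () ← trans (sym ij) (irrefl G i)

degreeSum : Graph n → ℕ
degreeSum {n} G = ∑[ i < n ] degree G i

_△_ : Graph n → Graph n → Graph n
G △ H = record
  { adj    = λ i j → adj G i j xor adj H i j
  ; sym    = λ i j → cong₂ _xor_ (adj-sym G i j) (adj-sym H i j)
  ; irrefl = λ i → cong₂ _xor_ (irrefl G i) (irrefl H i)
  }

degreeSum-△-self : (G : Graph n) → degreeSum (G △ G) ≡ 0
degreeSum-△-self {n} G = begin
  ∑[ i < n ] degree (G △ G) i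
    ≡⟨ sum-cong-≗ (λ i → trans (countFin-cong (xor-same ∘ adj G i)) (countFin-false {n})) ⟩
  ∑[ i < n ] 0
    ≡⟨ trans (∑-const n 0) (*-zeroʳ n) ⟩
  0 ∎
  where open ≡-Reasoning

degreeSum-△-triangle : (G H K : Graph n) → degreeSum (G △ K) ≤ degreeSum (G △ H) + degreeSum (H △ K)
degreeSum-△-triangle {n} G H K = begin
  ∑[ i < n ] degree (G △ K) i
    ≤⟨ ∑-mono-≤ (λ i → countFin-subadditive (λ j →
         𝟙-xor-triangle (adj G i j) (adj H i j) (adj K i j))) ⟩
  ∑[ i < n ] (degree (G △ H) i + degree (H △ K) i)
    ≡⟨ ∑-distrib-+ (degree (G △ H)) (degree (H △ K)) ⟩
  degreeSum (G △ H) + degreeSum (H △ K)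
    ∎
  where
  open ≤-Reasoning
  𝟙-xor-triangle : ∀ x y z → 𝟙 (x xor z) ≤ 𝟙 (x xor y) + 𝟙 (y xor z)
  𝟙-xor-triangle false false z = ≤-refl
  𝟙-xor-triangle true true z = ≤-refl
  𝟙-xor-triangle false true true = ≤-refl
  𝟙-xor-triangle false true false = z≤n
  𝟙-xor-triangle true false true = z≤n
  𝟙-xor-triangle true false false = ≤-refl

edge : Fin n → Fin n → Fin n → Fin n → Bool
edge a b i j = (i == a ∧ j == b) ∨ (i == b ∧ j == a)

single : (a b : Fin n) → a ≢ b → Graph n
single a b a≢b = record
  { adj    = edge a b
  ; sym    = edge-sym
  ; irrefl = edge-irrefl
  }
  where
  edge-sym : ∀ i j → edge a b i j ≡ edge a b j i
  edge-sym i j = trans (cong₂ _∨_ (∧-comm (i == a) (j == b)) (∧-comm (i == b) (j == a)))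
                       (∨-comm (j == b ∧ i == a) (j == a ∧ i == b))
  edge-irrefl : ∀ i → edge a b i i ≡ false
  edge-irrefl i with i ≟ a | i ≟ b
  ... | yes refl | yes refl = ⊥-elim (a≢b refl)
  ... | yes _    | no _     = refl
  ... | no _     | yes _    = refl
  ... | no _     | no _     = refl

degreeSum-single : {a b : Fin n} (a≢b : a ≢ b) → degreeSum (single a b a≢b) ≤ 2
degreeSum-single {n} {a} {b} a≢b = begin
  ∑[ i < n ] degree (single a b a≢b) i            ≤⟨ ∑-mono-≤ degree-single ⟩
  ∑[ i < n ] (𝟙 (i == a) + 𝟙 (i == b))            ≡⟨ ∑-distrib-+ (𝟙 ∘ (_== a)) (𝟙 ∘ (_== b)) ⟩
  ∑[ i < n ] 𝟙 (i == a) + ∑[ i < n ] 𝟙 (i == b)   ≡⟨ cong₂ _+_ (countFin-∑ (_== a)) (countFin-∑ (_== b)) ⟨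
  countFin n (_== a) + countFin n (_== b)         ≡⟨ cong₂ _+_ (countFin-indicator a) (countFin-indicator b) ⟩
  2                                               ∎
  where
  open ≤-Reasoning
  𝟙-∨-≤ : ∀ x y → 𝟙 (x ∨ y) ≤ 𝟙 x + 𝟙 y
  𝟙-∨-≤ true y = m≤m+n 1 (𝟙 y)
  𝟙-∨-≤ false y = ≤-refl
  degree-single : ∀ i → degree (single a b a≢b) i ≤ 𝟙 (i == a) + 𝟙 (i == b)
  degree-single i = begin
    degree (single a b a≢b) i
      ≤⟨ countFin-subadditive (λ j → 𝟙-∨-≤ (i == a ∧ j == b) (i == b ∧ j == a)) ⟩
    countFin n (λ j → i == a ∧ j == b) + countFin n (λ j → i == b ∧ j == a)
      ≡⟨ cong₂ _+_ (countFin-∧-indicator (i == a) b) (countFin-∧-indicator (i == b) a) ⟩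
    𝟙 (i == a) + 𝟙 (i == b)
      ∎

toggle : (G : Graph n) (a b : Fin n) → a ≢ b → Graph n
toggle G a b a≢b = single a b a≢b △ G

degreeSum-toggle : (G : Graph n) {a b : Fin n} (a≢b : a ≢ b) → degreeSum (G △ toggle G a b a≢b) ≤ 2
degreeSum-toggle {n} G {a} {b} a≢b = begin
  ∑[ i < n ] degree (G △ toggle G a b a≢b) i
    ≡⟨ sum-cong-≗ (λ i → countFin-cong (λ j → xor-absorb (adj G i j) (edge a b i j))) ⟩
  degreeSum (single a b a≢b)
    ≤⟨ degreeSum-single a≢b ⟩
  2 ∎
  where
  open ≤-Reasoning
  xor-absorb : ∀ x y → x xor (y xor x) ≡ y
  xor-absorb false y = xor-identityʳ y
  xor-absorb true true = refl
  xor-absorb true false = refl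

module _ (G : Graph n) {a b : Fin n} (a≢b : a ≢ b) where

  adj-toggle-other : {i : Fin n} → i ≢ a → i ≢ b → ∀ j → adj (toggle G a b a≢b) i j ≡ adj G i j
  adj-toggle-other i≢a i≢b j rewrite ==-≢ i≢a | ==-≢ i≢b = refl

  degree-toggle-other : {i : Fin n} → i ≢ a → i ≢ b → degree (toggle G a b a≢b) i ≡ degree G i
  degree-toggle-other i≢a i≢b = countFin-cong (adj-toggle-other i≢a i≢b)

  adj-toggleˡ : ∀ j → adj (toggle G a b a≢b) a j ≡ (j == b) xor adj G a j
  adj-toggleˡ j rewrite ==-refl a | ==-≢ a≢b = cong (_xor adj G a j) (∨-identityʳ (j == b))

  adj-toggleʳ : ∀ j → adj (toggle G a b a≢b) b j ≡ (j == a) xor adj G b j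
  adj-toggleʳ j rewrite ==-refl b | ==-≢ (a≢b ∘ sym) = refl

  degree-toggle-edge : adj G a b ≡ true →
                       suc (degree (toggle G a b a≢b) a) ≡ degree G a ×
                       suc (degree (toggle G a b a≢b) b) ≡ degree G b
  degree-toggle-edge ab =
    trans (cong suc (countFin-cong adj-toggleˡ)) (countFin-flip-true b (adj G a) ab) ,
    trans (cong suc (countFin-cong adj-toggleʳ)) (countFin-flip-true a (adj G b) (trans (adj-sym G b a) ab))

  degree-toggle-nonedge : adj G a b ≡ false →
                          degree (toggle G a b a≢b) a ≡ suc (degree G a) ×
                          degree (toggle G a b a≢b) b ≡ suc (degree G b)
  degree-toggle-nonedge ab =
    trans (countFin-cong adj-toggleˡ) (countFin-flip-false b (adj G a) ab) ,
    trans (countFin-cong adj-toggleʳ) (countFin-flip-false a (adj G b) (trans (adj-sym G b a) ab))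

complement : Graph n → Graph n
complement G = record
  { adj    = λ i j → not (j == i) ∧ not (adj G i j)
  ; sym    = λ i j → cong₂ (λ e x → not e ∧ not x) (==-sym j i) (adj-sym G i j)
  ; irrefl = λ i → cong (λ e → not e ∧ not (adj G i i)) (==-refl i)
  }

complement-degree : (G : Graph n) (i : Fin n) → degree (complement G) i + suc (degree G i) ≡ n
complement-degree {n} G i = begin
  degree (complement G) i + suc (degree G i)
    ≡⟨ cong₂ _+_ (countFin-cong complement-row) (sym (countFin-flip-false i (adj G i) (irrefl G i))) ⟩
  countFin n (not ∘ closed) + countFin n closed
    ≡⟨ countFin-not closed ⟩
  n ∎
  where
  open ≡-Reasoning
  closed : Fin n → Bool
  closed j = (j == i) xor adj G i j
  complement-row : ∀ j → adj (complement G) i j ≡ not (closed j)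
  complement-row j with j ≟ i
  ... | yes refl rewrite irrefl G j = refl
  ... | no _ = refl

degree-complement : (G : Graph n) {i : Fin n} {c k : ℕ} →
                    c + suc k ≡ n → degree G i ≡ k → degree (complement G) i ≡ c
degree-complement {n} G {i} {c} {k} c+k+1≡n deg≡k = +-cancelʳ-≡ (suc k) _ _ (begin
  degree (complement G) i + suc k              ≡⟨ cong (λ x → degree (complement G) i + suc x) deg≡k ⟨
  degree (complement G) i + suc (degree G i)   ≡⟨ complement-degree G i ⟩
  n                                            ≡⟨ c+k+1≡n ⟨
  c + suc k                                    ∎)
  where open ≡-Reasoning

degreeSum-△-complement : (G H : Graph n) → degreeSum (G △ complement H) ≡ degreeSum (complement G △ H)
degreeSum-△-complement G H = sum-cong-≗ (λ i → countFin-cong (same-row i))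
  where
  same-row : ∀ i j → adj (G △ complement H) i j ≡ adj (complement G △ H) i j
  same-row i j with j ≟ i
  ... | yes refl rewrite irrefl G j | irrefl H j = refl
  ... | no _ = trans (sym (not-distribʳ-xor (adj G i j) (adj H i j)))
                     (not-distribˡ-xor (adj G i j) (adj H i j))

-- Written like symDiffSize, so that symDiffSize G H is edgeCount (G △ H) by definition.
edgeCount : Graph n → ℕ
edgeCount {n} G = sum (map (λ i → countFin n (λ j → (toℕ i <ᵇ toℕ j) ∧ adj G i j)) (allFin n))

handshake : (G : Graph n) → degreeSum G ≡ 2 * edgeCount G
handshake {n} G = begin
  ∑[ i < n ] degree G i
    ≡⟨ sum-cong-≗ (λ i → trans (countFin-∑ (adj G i)) (sum-cong-≗ (split i))) ⟩
  ∑[ i < n ] ∑[ j < n ] (forward i j + backward i j)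
    ≡⟨ sum-cong-≗ (λ i → ∑-distrib-+ (forward i) (backward i)) ⟩
  ∑[ i < n ] (∑[ j < n ] forward i j + ∑[ j < n ] backward i j)
    ≡⟨ ∑-distrib-+ (λ i → ∑[ j < n ] forward i j) _ ⟩
  E + ∑[ i < n ] ∑[ j < n ] backward i j
    ≡⟨ cong (E +_) (∑-comm backward) ⟩
  E + ∑[ j < n ] ∑[ i < n ] backward i j
    ≡⟨ cong (E +_) (sum-cong-≗ λ j → sum-cong-≗ λ i →
         cong (λ x → 𝟙 ((toℕ j <ᵇ toℕ i) ∧ x)) (adj-sym G i j)) ⟩
  E + E
    ≡⟨ cong (E +_) (+-identityʳ E) ⟨
  2 * E
    ≡⟨ cong (2 *_) edgeCount-∑ ⟨
  2 * edgeCount G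
    ∎
  where
  open ≡-Reasoning
  forward backward : Fin n → Fin n → ℕ
  forward i j = 𝟙 ((toℕ i <ᵇ toℕ j) ∧ adj G i j)
  backward i j = 𝟙 ((toℕ j <ᵇ toℕ i) ∧ adj G i j)
  E = ∑[ i < n ] ∑[ j < n ] forward i j
  edgeCount-∑ : edgeCount G ≡ E
  edgeCount-∑ = trans (sum-map-allFin (λ i → countFin n (λ j → (toℕ i <ᵇ toℕ j) ∧ adj G i j)))
                      (sum-cong-≗ (λ i → countFin-∑ (λ j → (toℕ i <ᵇ toℕ j) ∧ adj G i j)))
  split : ∀ i j → 𝟙 (adj G i j) ≡ forward i j + backward i j
  split i j with toℕ i <ᵇ toℕ j | <ᵇ-reflects-< (toℕ i) (toℕ j)
               | toℕ j <ᵇ toℕ i | <ᵇ-reflects-< (toℕ j) (toℕ i)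
  ... | true  | ofʸ i<j | true  | ofʸ j<i = ⊥-elim (<-asym i<j j<i)
  ... | true  | _       | false | _       = sym (+-identityʳ _)
  ... | false | _       | true  | _       = refl
  ... | false | ofⁿ i≮j | false | ofⁿ j≮i
    rewrite toℕ-injective (≤-antisym (≮⇒≥ j≮i) (≮⇒≥ i≮j)) = cong 𝟙 (irrefl G j)

symDiffSize-degreeSum : (G H : Graph n) → 2 * symDiffSize G H ≡ degreeSum (G △ H)
symDiffSize-degreeSum G H = sym (handshake (G △ H))

symDiffSize-complement : (G H : Graph n) → symDiffSize G (complement H) ≡ symDiffSize (complement G) H
symDiffSize-complement G H = *-cancelˡ-≡ _ _ 2 (begin
  2 * symDiffSize G (complement H)   ≡⟨ symDiffSize-degreeSum G (complement H) ⟩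
  degreeSum (G △ complement H)       ≡⟨ degreeSum-△-complement G H ⟩
  degreeSum (complement G △ H)       ≡⟨ symDiffSize-degreeSum (complement G) H ⟨
  2 * symDiffSize (complement G) H   ∎)
  where open ≡-Reasoning

-- Lowering two vertices of maximum degree

transpose-fix : {i j k : Fin n} → k ≢ i → k ≢ j → transpose i j ⟨$⟩ʳ k ≡ k
transpose-fix {i = i} {j} {k} k≢i k≢j rewrite dec-false (k ≟ i) k≢i | dec-false (k ≟ j) k≢j = refl

-- Swapping x and v maps the neighbours of v into those of x (the neighbour x of v goes to v, a
-- neighbour of x), and misses the neighbour u of x.
degree-<-dominating : (G : Graph n) {v x u : Fin n} →
                      (∀ j → adj G v j ≡ true → j ≢ x → adj G x j ≡ true) →
                      adj G x u ≡ true → adj G v u ≡ false → u ≢ v → degree G v < degree G x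
degree-<-dominating {n} G {v} {x} {u} dominated xu vu u≢v = begin-strict
  degree G v                          ≡⟨ countFin-∑ (adj G v) ⟩
  ∑[ j < n ] 𝟙 (adj G v j)            <⟨ ∑-mono-< u pointwise gain ⟩
  ∑[ j < n ] 𝟙 (adj G x (τ ⟨$⟩ʳ j))   ≡⟨ ∑-permute (𝟙 ∘ adj G x) τ ⟨
  ∑[ j < n ] 𝟙 (adj G x j)            ≡⟨ countFin-∑ (adj G x) ⟨
  degree G x                          ∎
  where
  open ≤-Reasoning
  τ = transpose x v
  pointwise : ∀ j → 𝟙 (adj G v j) ≤ 𝟙 (adj G x (τ ⟨$⟩ʳ j))
  pointwise j with j ≟ x
  ... | yes refl = ≤-reflexive (cong 𝟙 (adj-sym G v j))
  ... | no j≢x with j ≟ v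
  ...   | yes refl rewrite irrefl G j = z≤n
  ...   | no j≢v with adj G v j in vj
  ...     | false = z≤n
  ...     | true = ≤-reflexive (cong 𝟙 (sym (dominated j vj j≢x)))
  gain : 𝟙 (adj G v u) < 𝟙 (adj G x (τ ⟨$⟩ʳ u))
  gain rewrite transpose-fix (adj⇒≢ G xu ∘ sym) u≢v | vu | xu = s≤s z≤n

record Lowering (G : Graph n) (s₁ s₂ : Fin n) : Set where
  field
    graph     : Graph n
    lowered₁  : suc (degree graph s₁) ≡ degree G s₁
    lowered₂  : suc (degree graph s₂) ≡ degree G s₂
    unchanged : ∀ i → i ≢ s₁ → i ≢ s₂ → degree graph i ≡ degree G i
    cost      : degreeSum (G △ graph) ≤ 6

lowering-adjacent : (G : Graph n) {s₁ s₂ : Fin n} (s₁≢s₂ : s₁ ≢ s₂) → adj G s₁ s₂ ≡ true →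
                    Lowering G s₁ s₂
lowering-adjacent G s₁≢s₂ s₁s₂ = record
  { graph     = toggle G _ _ s₁≢s₂
  ; lowered₁  = proj₁ (degree-toggle-edge G s₁≢s₂ s₁s₂)
  ; lowered₂  = proj₂ (degree-toggle-edge G s₁≢s₂ s₁s₂)
  ; unchanged = λ i → degree-toggle-other G s₁≢s₂
  ; cost      = ≤-trans (degreeSum-toggle G s₁≢s₂) (m≤m+n 2 4)
  }

module AlternatingPath (G : Graph n) {s₁ s₂ x y : Fin n}
                       (s₁≢s₂ : s₁ ≢ s₂) (s₁s₂ : adj G s₁ s₂ ≡ false) (s₁x : adj G s₁ x ≡ true)
                       (s₂y : adj G s₂ y ≡ true) (x≢y : x ≢ y) (xy : adj G x y ≡ false) where

  private
    s₁≢x : s₁ ≢ x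
    s₁≢x = adj⇒≢ G s₁x
    s₂≢y : s₂ ≢ y
    s₂≢y = adj⇒≢ G s₂y
    x≢s₂ : x ≢ s₂
    x≢s₂ refl with () ← trans (sym s₁s₂) s₁x
    s₁≢y : s₁ ≢ y
    s₁≢y refl with () ← trans (sym s₁s₂) (trans (adj-sym G s₁ s₂) s₂y)

  G₁ G₂ G₃ : Graph n
  G₁ = toggle G s₁ x s₁≢x
  G₂ = toggle G₁ s₂ y s₂≢y
  G₃ = toggle G₂ x y x≢y

  s₂y-in-G₁ : adj G₁ s₂ y ≡ true
  s₂y-in-G₁ = trans (adj-toggle-other G s₁≢x (s₁≢s₂ ∘ sym) (x≢s₂ ∘ sym) y) s₂y

  xy-in-G₂ : adj G₂ x y ≡ false
  xy-in-G₂ = begin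
    adj G₂ x y   ≡⟨ adj-toggle-other G₁ s₂≢y x≢s₂ x≢y y ⟩
    adj G₁ x y   ≡⟨ adj-sym G₁ x y ⟩
    adj G₁ y x   ≡⟨ adj-toggle-other G s₁≢x (s₁≢y ∘ sym) (x≢y ∘ sym) x ⟩
    adj G y x    ≡⟨ adj-sym G y x ⟩
    adj G x y    ≡⟨ xy ⟩
    false        ∎
    where open ≡-Reasoning

  private
    removed-s₁x = degree-toggle-edge G s₁≢x s₁x
    removed-s₂y = degree-toggle-edge G₁ s₂≢y s₂y-in-G₁
    added-xy = degree-toggle-nonedge G₂ x≢y xy-in-G₂

  lowered₁ : suc (degree G₃ s₁) ≡ degree G s₁
  lowered₁ = begin
    suc (degree G₃ s₁)   ≡⟨ cong suc (degree-toggle-other G₂ x≢y s₁≢x s₁≢y) ⟩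
    suc (degree G₂ s₁)   ≡⟨ cong suc (degree-toggle-other G₁ s₂≢y s₁≢s₂ s₁≢y) ⟩
    suc (degree G₁ s₁)   ≡⟨ proj₁ removed-s₁x ⟩
    degree G s₁          ∎
    where open ≡-Reasoning

  lowered₂ : suc (degree G₃ s₂) ≡ degree G s₂
  lowered₂ = begin
    suc (degree G₃ s₂)   ≡⟨ cong suc (degree-toggle-other G₂ x≢y (x≢s₂ ∘ sym) s₂≢y) ⟩
    suc (degree G₂ s₂)   ≡⟨ proj₁ removed-s₂y ⟩
    degree G₁ s₂         ≡⟨ degree-toggle-other G s₁≢x (s₁≢s₂ ∘ sym) (x≢s₂ ∘ sym) ⟩
    degree G s₂          ∎
    where open ≡-Reasoning

  degree-x : degree G₃ x ≡ degree G x
  degree-x = begin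
    degree G₃ x          ≡⟨ proj₁ added-xy ⟩
    suc (degree G₂ x)    ≡⟨ cong suc (degree-toggle-other G₁ s₂≢y x≢s₂ x≢y) ⟩
    suc (degree G₁ x)    ≡⟨ proj₂ removed-s₁x ⟩
    degree G x           ∎
    where open ≡-Reasoning

  degree-y : degree G₃ y ≡ degree G y
  degree-y = begin
    degree G₃ y          ≡⟨ proj₂ added-xy ⟩
    suc (degree G₂ y)    ≡⟨ proj₂ removed-s₂y ⟩
    degree G₁ y          ≡⟨ degree-toggle-other G s₁≢x (s₁≢y ∘ sym) (x≢y ∘ sym) ⟩
    degree G y           ∎
    where open ≡-Reasoning

  unchanged : ∀ i → i ≢ s₁ → i ≢ s₂ → degree G₃ i ≡ degree G i
  unchanged i i≢s₁ i≢s₂ = by-cases (i ≟ x) (i ≟ y)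
    where
    by-cases : Dec (i ≡ x) → Dec (i ≡ y) → degree G₃ i ≡ degree G i
    by-cases (yes i≡x) _ = subst (λ k → degree G₃ k ≡ degree G k) (sym i≡x) degree-x
    by-cases (no _) (yes i≡y) = subst (λ k → degree G₃ k ≡ degree G k) (sym i≡y) degree-y
    by-cases (no i≢x) (no i≢y) =
      trans (degree-toggle-other G₂ x≢y i≢x i≢y)
        (trans (degree-toggle-other G₁ s₂≢y i≢s₂ i≢y) (degree-toggle-other G s₁≢x i≢s₁ i≢x))

  cost : degreeSum (G △ G₃) ≤ 6
  cost = begin
    degreeSum (G △ G₃)
      ≤⟨ degreeSum-△-triangle G G₁ G₃ ⟩
    degreeSum (G △ G₁) + degreeSum (G₁ △ G₃)
      ≤⟨ +-monoʳ-≤ (degreeSum (G △ G₁)) (degreeSum-△-triangle G₁ G₂ G₃) ⟩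
    degreeSum (G △ G₁) + (degreeSum (G₁ △ G₂) + degreeSum (G₂ △ G₃))
      ≤⟨ +-mono-≤ (degreeSum-toggle G s₁≢x)
                  (+-mono-≤ (degreeSum-toggle G₁ s₂≢y) (degreeSum-toggle G₂ x≢y)) ⟩
    6 ∎
    where open ≤-Reasoning

  lowering-path : Lowering G s₁ s₂
  lowering-path = record
    { graph = G₃ ; lowered₁ = lowered₁ ; lowered₂ = lowered₂ ; unchanged = unchanged ; cost = cost }

open AlternatingPath using (lowering-path)

lowering : (G : Graph n) {s₁ s₂ : Fin n} → s₁ ≢ s₂ → 0 < degree G s₁ →
           (∀ i → degree G i ≤ degree G s₂) → Lowering G s₁ s₂
lowering G {s₁} {s₂} s₁≢s₂ s₁-active s₂-maximal with adj G s₁ s₂ in s₁s₂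
... | true = lowering-adjacent G s₁≢s₂ s₁s₂
... | false with countFin-witness (adj G s₁) s₁-active
...   | x , s₁x with any? (λ y → (adj G s₂ y ≟ᵇ true) ×-dec ¬? (y ≟ x) ×-dec (adj G x y ≟ᵇ false))
...     | yes (y , s₂y , y≢x , xy) = lowering-path G s₁≢s₂ s₁s₂ s₁x s₂y (y≢x ∘ sym) xy
...     | no no-y = ⊥-elim (<⇒≱ s₂<x (s₂-maximal x))
  where
  dominated : ∀ j → adj G s₂ j ≡ true → j ≢ x → adj G x j ≡ true
  dominated j s₂j j≢x with adj G x j in xj
  ... | true = refl
  ... | false = ⊥-elim (no-y (j , s₂j , j≢x , xj))
  s₂<x : degree G s₂ < degree G x
  s₂<x = degree-<-dominating G dominated (trans (adj-sym G x s₁) s₁x) (trans (adj-sym G s₂ s₁) s₁s₂)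
                             s₁≢s₂

-- Graphs with all degrees d or d + 1

NearRegular : ℕ → Graph n → Set
NearRegular d G = ∀ i → degree G i ≡ d ⊎ degree G i ≡ suc d

isHigh : ℕ → Graph n → Fin n → Bool
isHigh d G i = does (degree G i ≟ℕ suc d)

highCount : ℕ → Graph n → ℕ
highCount {n} d G = countFin n (isHigh d G)

module _ {d : ℕ} (G : Graph n) (i : Fin n) where

  suc⇒isHigh : degree G i ≡ suc d → isHigh d G i ≡ true
  suc⇒isHigh = dec-true (degree G i ≟ℕ suc d)

  base⇒¬isHigh : degree G i ≡ d → isHigh d G i ≡ false
  base⇒¬isHigh deg≡d =
    dec-false (degree G i ≟ℕ suc d) (λ deg≡d+1 → <-irrefl (trans (sym deg≡d) deg≡d+1) (n<1+n d))

  isHigh⇒suc : isHigh d G i ≡ true → degree G i ≡ suc d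
  isHigh⇒suc = witness (degree G i ≟ℕ suc d)
    where
    witness : {A : Set} (a? : Dec A) → does a? ≡ true → A
    witness (yes a) _ = a
    witness (no _) ()

nearRegular-maximal : {d : ℕ} (G : Graph n) → NearRegular d G → (v : Fin n) → degree G v ≡ suc d →
                      ∀ i → degree G i ≤ degree G v
nearRegular-maximal {d = d} G nearRegular v deg-v i with nearRegular i
... | inj₁ deg≡d = ≤-trans (≤-reflexive deg≡d) (≤-trans (n≤1+n d) (≤-reflexive (sym deg-v)))
... | inj₂ deg≡d+1 = ≤-reflexive (trans deg≡d+1 (sym deg-v))

degreeSum-nearRegular : {d : ℕ} (G : Graph n) → NearRegular d G → degreeSum G ≡ n * d + highCount d G
degreeSum-nearRegular {n} {d} G nearRegular = begin
  ∑[ i < n ] degree G i                        ≡⟨ sum-cong-≗ pointwise ⟩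
  ∑[ i < n ] (d + 𝟙 (isHigh d G i))            ≡⟨ ∑-distrib-+ (λ _ → d) (𝟙 ∘ isHigh d G) ⟩
  ∑[ i < n ] d + ∑[ i < n ] 𝟙 (isHigh d G i)   ≡⟨ cong₂ _+_ (∑-const n d) (sym (countFin-∑ (isHigh d G))) ⟩
  n * d + highCount d G                        ∎
  where
  open ≡-Reasoning
  pointwise : ∀ i → degree G i ≡ d + 𝟙 (isHigh d G i)
  pointwise i with nearRegular i
  ... | inj₁ deg≡d =
    trans deg≡d (sym (trans (cong (λ b → d + 𝟙 b) (base⇒¬isHigh G i deg≡d)) (+-identityʳ d)))
  ... | inj₂ deg≡d+1 =
    trans deg≡d+1 (sym (trans (cong (λ b → d + 𝟙 b) (suc⇒isHigh G i deg≡d+1)) (+-comm d 1)))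

regular-of-highCount-zero : {d : ℕ} (G : Graph n) → NearRegular d G → highCount d G ≡ 0 → Regular d G
regular-of-highCount-zero G nearRegular none i with nearRegular i
... | inj₁ deg≡d = deg≡d
... | inj₂ deg≡d+1 =
  ⊥-elim (<-irrefl refl (subst (0 <_) none (countFin-positive _ i (suc⇒isHigh G i deg≡d+1))))

module _ {d : ℕ} {G : Graph n} {s₁ s₂ : Fin n} (s₁≢s₂ : s₁ ≢ s₂)
         (high₁ : degree G s₁ ≡ suc d) (high₂ : degree G s₂ ≡ suc d) (L : Lowering G s₁ s₂) where

  open Lowering L

  private
    base₁ : degree graph s₁ ≡ d
    base₁ = suc-injective (trans lowered₁ high₁)
    base₂ : degree graph s₂ ≡ d
    base₂ = suc-injective (trans lowered₂ high₂)

  nearRegular-lowered : NearRegular d G → NearRegular d graph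
  nearRegular-lowered nearRegular i with i ≟ s₁ | i ≟ s₂
  ... | yes refl | _ = inj₁ base₁
  ... | no _ | yes refl = inj₁ base₂
  ... | no i≢s₁ | no i≢s₂ rewrite unchanged i i≢s₁ i≢s₂ = nearRegular i

  highCount-lowered : highCount d G ≡ suc (suc (highCount d graph))
  highCount-lowered = begin
    countFin n (isHigh d G)
      ≡⟨ countFin-cong pointwise ⟩
    countFin n (λ i → (i == s₁) xor ((i == s₂) xor isHigh d graph i))
      ≡⟨ countFin-flip-false s₁ _ s₁-low ⟩
    suc (countFin n (λ i → (i == s₂) xor isHigh d graph i))
      ≡⟨ cong suc (countFin-flip-false s₂ _ (base⇒¬isHigh graph s₂ base₂)) ⟩
    suc (suc (countFin n (isHigh d graph)))
      ∎
    where
    open ≡-Reasoning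
    s₁-low : (s₁ == s₂) xor isHigh d graph s₁ ≡ false
    s₁-low rewrite ==-≢ s₁≢s₂ = base⇒¬isHigh graph s₁ base₁
    pointwise : ∀ i → isHigh d G i ≡ (i == s₁) xor ((i == s₂) xor isHigh d graph i)
    pointwise i with i ≟ s₁ | i ≟ s₂
    ... | yes refl | yes refl = ⊥-elim (s₁≢s₂ refl)
    ... | yes refl | no _ rewrite base⇒¬isHigh graph s₁ base₁ = suc⇒isHigh G s₁ high₁
    ... | no _ | yes refl rewrite base⇒¬isHigh graph s₂ base₂ = suc⇒isHigh G s₂ high₂
    ... | no i≢s₁ | no i≢s₂ = cong (λ k → does (k ≟ℕ suc d)) (sym (unchanged i i≢s₁ i≢s₂))

regularise : ∀ k {d} (G : Graph n) → NearRegular d G → highCount d G ≡ k → parity k ≡ 0ℙ →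
             Σ (Graph n) λ R → Regular d R × degreeSum (G △ R) ≤ 3 * k
regularise zero G nearRegular none _ =
  G , regular-of-highCount-zero G nearRegular none , ≤-reflexive (degreeSum-△-self G)
regularise (suc zero) G _ _ ()
regularise (suc (suc k)) {d} G nearRegular count even =
  let s₁ , s₂ , s₁≢s₂ , high₁ , high₂ =
        countFin-two-witnesses (isHigh d G) (subst (2 ≤_) (sym count) (s≤s (s≤s z≤n)))
      deg₁ = isHigh⇒suc G s₁ high₁
      deg₂ = isHigh⇒suc G s₂ high₂
      L = lowering G s₁≢s₂ (subst (0 <_) (sym deg₁) z<s) (nearRegular-maximal G nearRegular s₂ deg₂)
      G′ = Lowering.graph L
      count′ = suc-injective (suc-injective (trans (sym (highCount-lowered s₁≢s₂ deg₁ deg₂ L)) count))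
      nearRegular′ = nearRegular-lowered s₁≢s₂ deg₁ deg₂ L nearRegular
      R , regular , cost = regularise k G′ nearRegular′ count′ even
  in R , regular , (begin
    degreeSum (G △ R)                         ≤⟨ degreeSum-△-triangle G G′ R ⟩
    degreeSum (G △ G′) + degreeSum (G′ △ R)   ≤⟨ +-mono-≤ (Lowering.cost L) cost ⟩
    6 + 3 * k                                 ≡⟨ *-distribˡ-+ 3 2 k ⟨
    3 * suc (suc k)                           ∎)
  where open ≤-Reasoning

regularise-even : {d : ℕ} (G : Graph n) → NearRegular d G → parity (highCount d G) ≡ 0ℙ →
                  Σ (Graph n) λ R → Regular d R × 2 * symDiffSize G R ≤ 3 * n
regularise-even {n} {d} G nearRegular even =
  let R , regular , cost = regularise _ G nearRegular refl even
  in R , regular , (begin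
    2 * symDiffSize G R   ≡⟨ symDiffSize-degreeSum G R ⟩
    degreeSum (G △ R)     ≤⟨ cost ⟩
    3 * highCount d G     ≤⟨ *-monoʳ-≤ 3 (countFin-≤ (isHigh d G)) ⟩
    3 * n                 ∎)
  where open ≤-Reasoning

-- Passing to the complement

0ℙ≢1ℙ : 0ℙ ≢ 1ℙ
0ℙ≢1ℙ ()

module _ {c d : ℕ} (c+d+2≡n : c + suc (suc d) ≡ n) where

  private
    c+1+d+1≡n : suc c + suc d ≡ n
    c+1+d+1≡n = trans (sym (+-suc c (suc d))) c+d+2≡n

  nearRegular-complement : (G : Graph n) → NearRegular d G → NearRegular c (complement G)
  nearRegular-complement G nearRegular i with nearRegular i
  ... | inj₁ deg≡d = inj₂ (degree-complement G c+1+d+1≡n deg≡d)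
  ... | inj₂ deg≡d+1 = inj₁ (degree-complement G c+d+2≡n deg≡d+1)

  regular-complement : (R : Graph n) → Regular c R → Regular (suc d) (complement R)
  regular-complement R regular i = degree-complement R (trans (+-comm (suc d) (suc c)) c+1+d+1≡n) (regular i)

  highCount-complement : (G : Graph n) → NearRegular d G → highCount c (complement G) + highCount d G ≡ n
  highCount-complement G nearRegular =
    trans (cong (_+ highCount d G) (countFin-cong high-swapped)) (countFin-not (isHigh d G))
    where
    high-swapped : ∀ i → isHigh c (complement G) i ≡ not (isHigh d G i)
    high-swapped i with nearRegular i
    ... | inj₁ deg≡d =
      trans (suc⇒isHigh (complement G) i (degree-complement G c+1+d+1≡n deg≡d))
            (cong not (sym (base⇒¬isHigh G i deg≡d)))
    ... | inj₂ deg≡d+1 =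
      trans (base⇒¬isHigh (complement G) i (degree-complement G c+d+2≡n deg≡d+1))
            (cong not (sym (suc⇒isHigh G i deg≡d+1)))

  parity-highCount-complement : (G : Graph n) → NearRegular d G → parity (highCount d G) ≡ 1ℙ →
                                parity (highCount c (complement G)) ≡ 0ℙ
  parity-highCount-complement G nearRegular odd with parity (highCount c (complement G)) in oddᶜ
  ... | 0ℙ = refl
  ... | 1ℙ = ⊥-elim (0ℙ≢1ℙ (begin
    0ℙ                                                   ≡⟨ *-homo-* 2 (edgeCount G) ⟨
    parity (2 * edgeCount G)                             ≡⟨ cong parity (handshake G) ⟨
    parity (degreeSum G)                                 ≡⟨ cong parity (degreeSum-nearRegular G nearRegular) ⟩
    parity (n * d + H)                                   ≡⟨ +-homo-+ (n * d) H ⟩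
    parity (n * d) ℙ.+ parity H                          ≡⟨ cong (ℙ._+ parity H) (*-homo-* n d) ⟩
    parity n ℙ.* parity d ℙ.+ parity H
      ≡⟨ cong (λ p → p ℙ.* parity d ℙ.+ parity H) parity-n ⟩
    (parity Hᶜ ℙ.+ parity H) ℙ.* parity d ℙ.+ parity H
      ≡⟨ cong₂ (λ p q → (p ℙ.+ q) ℙ.* parity d ℙ.+ q) oddᶜ odd ⟩
    1ℙ                                                   ∎))
    where
    open ≡-Reasoning
    H = highCount d G
    Hᶜ = highCount c (complement G)
    parity-n : parity n ≡ parity Hᶜ ℙ.+ parity H
    parity-n = trans (cong parity (sym (highCount-complement G nearRegular))) (+-homo-+ Hᶜ H)

complement-of-odd : {d : ℕ} (G : Graph n) → NearRegular d G → parity (highCount d G) ≡ 1ℙ →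
                    Σ ℕ λ c → c + suc (suc d) ≡ n × NearRegular c (complement G) ×
                              parity (highCount c (complement G)) ≡ 0ℙ
complement-of-odd {n} {d} G nearRegular odd =
  c , c+d+2≡n , nearRegular-complement c+d+2≡n G nearRegular ,
  parity-highCount-complement c+d+2≡n G nearRegular odd
  where
  some-high : ∃ λ i → isHigh d G i ≡ true
  some-high = countFin-witness (isHigh d G) (n≢0⇒n>0 λ none → 0ℙ≢1ℙ (trans (sym (cong parity none)) odd))
  i₀ = proj₁ some-high
  c = degree (complement G) i₀
  c+d+2≡n : c + suc (suc d) ≡ n
  c+d+2≡n = subst (λ k → c + suc k ≡ n) (isHigh⇒suc G i₀ (proj₂ some-high)) (complement-degree G i₀)

theorem3 : (n d : ℕ) (G : Graph n) →
           (∀ i → degree G i ≡ d ⊎ degree G i ≡ suc d) →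
           Σ ℕ (λ r → Σ (Graph n) (λ R →
             (r ≡ d ⊎ r ≡ suc d) × Regular r R × 2 * symDiffSize G R ≤ 3 * n))
theorem3 n d G nearRegular with parity (highCount d G) in hc-parity
... | 0ℙ =
  let R , regular , close = regularise-even G nearRegular hc-parity
  in d , R , inj₁ refl , regular , close
... | 1ℙ =
  let c , c+d+2≡n , nearRegularᶜ , evenᶜ = complement-of-odd G nearRegular hc-parity
      R , regular , close = regularise-even (complement G) nearRegularᶜ evenᶜ
  in suc d , complement R , inj₂ refl , regular-complement c+d+2≡n R regular ,
     subst (λ s → 2 * s ≤ 3 * n) (sym (symDiffSize-complement G R)) close
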